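{- Let $k\geq 1$, $n=8k+7$, $G=C(n,\pm\{1,2,3,4\})$, $a\in\mathbb{Z}_n$, and let $A_i=\{a+4i,a+4i+1\}$ for $0\leq i\leq k+1$ and $B_i=\{a+2+4i,a+3+4i\}$ for $0\leq i\leq k$ (indices mod $n$). Suppose $A=(A_0,B_0,A_1,B_1,\dots,A_k,B_k,A_{k+1})$ is an $S$-cluster for some $S\subseteq V(G)$. If $X\subseteq V(G)$ resolves $A$, then $|X|\geq 3$.
   Context: $C(n,\pm\{1,2,3,4\})$ is the graph on $\mathbb{Z}_n$ where distinct $i,j$ are adjacent iff $j-i\equiv\pm s\pmod n$ for some $s\in\{1,2,3,4\}$; $d$ is graph distance, and $r(v|X)=(d(v,x))_{x\in X}$. For $S\subseteq V$, a set $B$ is an $S$-block if $r(a|S)=r(b|S)$ for all $a,b\in B$. A tuple $(A_1,\dots,A_p)$ of $S$-blocks is an $S$-cluster if the $A_i$ are contained in distinct equivalence classes of $u\sim_S v\iff r(u|S)=r(v|S)$. A set $X$ resolves a tuple $(A_1,\dots,A_p)$ if $r(a|X)\neq r(b|X)$ for all distinct $a,b$ in the same $A_j$. -}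

module Defs where

open import Data.Nat using (ℕ; zero; suc; _+_; _*_; _≤_; NonZero)
open import Data.Nat.DivMod using (_mod_)
open import Data.Fin using (Fin; toℕ)
open import Data.Fin.Subset using (Subset; _∈_)
open import Data.List using (List; []; _∷_; _++_; concatMap; upTo; length; lookup)
open import Data.Product using (Σ; _×_; ∃)
open import Data.Sum using (_⊎_)
open import Relation.Binary.PropositionalEquality using (_≡_; _≢_)
open import Relation.Nullary using (¬_)

_⊕_ : ∀ {n} .{{_ : NonZero n}} → Fin n → ℕ → Fin n
_⊕_ {n} v m = (toℕ v + m) mod n

Gen : ℕ → Set
Gen s = (s ≡ 1) ⊎ (s ≡ 2) ⊎ (s ≡ 3) ⊎ (s ≡ 4)

Adj : ∀ {n} .{{_ : NonZero n}} → Fin n → Fin n → Set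
Adj i j = i ≢ j × Σ ℕ (λ s → Gen s × ((i ⊕ s ≡ j) ⊎ (j ⊕ s ≡ i)))

data Walk {n} .{{_ : NonZero n}} : Fin n → Fin n → ℕ → Set where
  here : ∀ {u} → Walk u u 0
  step : ∀ {u w v m} → Adj u w → Walk w v m → Walk u v (suc m)

IsDist : ∀ {n} .{{_ : NonZero n}} → Fin n → Fin n → ℕ → Set
IsDist u v m = Walk u v m × (∀ m′ → Walk u v m′ → m ≤ m′)

SameRep : ∀ {n} .{{_ : NonZero n}} → Subset n → Fin n → Fin n → Set
SameRep X u v = ∀ x → x ∈ X → ∀ m₁ m₂ → IsDist u x m₁ → IsDist v x m₂ → m₁ ≡ m₂

Block : ℕ → Set₁
Block n = Fin n → Set

IsSBlock : ∀ {n} .{{_ : NonZero n}} → Subset n → Block n → Set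
IsSBlock S B = ∀ a b → B a → B b → SameRep S a b

IsSCluster : ∀ {n} .{{_ : NonZero n}} → Subset n → List (Block n) → Set
IsSCluster S As =
  (∀ i → IsSBlock S (lookup As i)) ×
  (∀ i j → i ≢ j → ∀ a b → lookup As i a → lookup As j b → ¬ SameRep S a b)

Resolves : ∀ {n} .{{_ : NonZero n}} → Subset n → List (Block n) → Set
Resolves X As = ∀ i a b → lookup As i a → lookup As i b → a ≢ b → ¬ SameRep X a b

-- n = 8k + 7 (written 7 + 8k so that NonZero is found definitionally)
N : ℕ → ℕ
N k = 7 + 8 * k

Ablk : ∀ k → Fin (N k) → ℕ → Block (N k)
Ablk k a i v = (v ≡ a ⊕ (4 * i)) ⊎ (v ≡ a ⊕ (4 * i + 1))

Bblk : ∀ k → Fin (N k) → ℕ → Block (N k)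
Bblk k a i v = (v ≡ a ⊕ (2 + 4 * i)) ⊎ (v ≡ a ⊕ (3 + 4 * i))

clusterA : ∀ k → Fin (N k) → List (Block (N k))
clusterA k a = concatMap (λ i → Ablk k a i ∷ Bblk k a i ∷ []) (upTo (suc k))
               ++ (Ablk k a (suc k) ∷ [])

-- The distance between vertices at offset r in C(n, ±{1,2,3,4}) is ⌈min(r, n − r)/4⌉.
-- For n = 8k + 7 this value changes between offsets r and r + 1 only at the boundaries
-- r = 0, 4, …, 4k and their mirror images n − 1 − r; no two boundaries are 2 apart, nor 4k + 4 apart
-- (modulo n). The cluster consists of the pairs {a + 2j, a + 2j + 1}, j = 0, …, 2k + 2, and a landmark x
-- can separate such a pair only when (a − x) + 2j is a boundary. So the positions j separated by one
-- landmark form an independent set of the odd cycle 0 — 1 — ⋯ — 2k + 2 — 0, and two landmarks can never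
-- separate every pair.
module Submission where

open import Defs
open import Data.Nat using (ℕ; zero; suc; _+_; _*_; _∸_; _≤_; _<_; _⊓_; z≤n; s≤s; s≤s⁻¹; z<s; NonZero; _<?_; _≤?_)
open import Data.Nat.Properties
open import Data.Nat.DivMod
  using (_%_; m%n<n; n%n≡0; m%n≤m; m<n⇒m%n≡m; m%n%n≡m%n; %-distribˡ-+; [m+n]%n≡m%n; m≤n⇒[n∸m]%m≡n%m; [m+kn]%n≡m%n)
open import Data.Nat.Tactic.RingSolver using (solve-∀)
open import Data.Fin using (Fin; toℕ) renaming (_≟_ to _≟ᶠ_)
open import Data.Fin.Properties using (toℕ-fromℕ<; toℕ-injective; toℕ<n)
open import Data.Fin.Subset using (Subset; _∈_; ∣_∣; _-_)
open import Data.Fin.Subset.Properties using (nonempty?; x∈p⇒∣p-x∣<∣p∣; x∈p∧x≢y⇒x∈p-y)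
open import Data.Product using (Σ-syntax; ∃-syntax; _×_; _,_; proj₁; proj₂)
open import Data.Sum using (_⊎_; inj₁; inj₂)
import Data.Sum as Sum
open import Data.List using (List; concatMap; upTo) renaming (_∷_ to _∷ₗ_; [] to []ₗ)
open import Data.List.Membership.Propositional using () renaming (_∈_ to _∈ₗ_)
import Data.List.Relation.Unary.Any as Any
open import Data.List.Relation.Unary.Any.Properties using (lookup-index)
open import Data.List.Membership.Propositional.Properties using (∈-++⁺ˡ; ∈-++⁺ʳ; ∈-concatMap⁺; ∈-upTo⁺)
open import Data.Vec using (Vec; []; _∷_; replicate)
open import Data.Vec.Membership.Propositional using () renaming (_∈_ to _∈ᵥ_)
open import Data.Vec.Relation.Unary.Any using (here; there)
open import Relation.Binary.PropositionalEquality
open import Function using (_∘_)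
open import Relation.Nullary using (¬_; yes; no; contradiction)
open import Relation.Nullary.Decidable using (True; toWitness)

⌈_/4⌉ : ℕ → ℕ
⌈ 0 /4⌉ = 0
⌈ 1 /4⌉ = 1
⌈ 2 /4⌉ = 1
⌈ 3 /4⌉ = 1
⌈ 4 /4⌉ = 1
⌈ suc (suc (suc (suc (suc r)))) /4⌉ = suc ⌈ suc r /4⌉

⌈4+r/4⌉≡1+⌈r/4⌉ : ∀ r → ⌈ 4 + r /4⌉ ≡ suc ⌈ r /4⌉
⌈4+r/4⌉≡1+⌈r/4⌉ zero    = refl
⌈4+r/4⌉≡1+⌈r/4⌉ (suc r) = refl

⌈r/4⌉≤⌈1+r/4⌉ : ∀ r → ⌈ r /4⌉ ≤ ⌈ suc r /4⌉
⌈r/4⌉≤⌈1+r/4⌉ 0 = z≤n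
⌈r/4⌉≤⌈1+r/4⌉ 1 = ≤-refl
⌈r/4⌉≤⌈1+r/4⌉ 2 = ≤-refl
⌈r/4⌉≤⌈1+r/4⌉ 3 = ≤-refl
⌈r/4⌉≤⌈1+r/4⌉ 4 = s≤s z≤n
⌈r/4⌉≤⌈1+r/4⌉ (suc (suc (suc (suc (suc r))))) = s≤s (⌈r/4⌉≤⌈1+r/4⌉ (suc r))

⌈/4⌉-mono-≤ : ∀ {r s} → r ≤ s → ⌈ r /4⌉ ≤ ⌈ s /4⌉
⌈/4⌉-mono-≤ {s = zero}  z≤n  = ≤-refl
⌈/4⌉-mono-≤ {s = suc s} r≤1+s with m≤n⇒m<n∨m≡n r≤1+s
... | inj₁ (s≤s r≤s) = ≤-trans (⌈/4⌉-mono-≤ r≤s) (⌈r/4⌉≤⌈1+r/4⌉ s)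
... | inj₂ refl      = ≤-refl

⌈/4⌉-≤-suc : ∀ {r s} → r ≤ 4 + s → ⌈ r /4⌉ ≤ suc ⌈ s /4⌉
⌈/4⌉-≤-suc {s = s} r≤4+s = ≤-trans (⌈/4⌉-mono-≤ r≤4+s) (≤-reflexive (⌈4+r/4⌉≡1+⌈r/4⌉ s))

⌈1+r/4⌉-cases : ∀ r → ⌈ suc r /4⌉ ≡ ⌈ r /4⌉ ⊎ ∃[ m ] r ≡ 4 * m
⌈1+r/4⌉-cases 0 = inj₂ (0 , refl)
⌈1+r/4⌉-cases 1 = inj₁ refl
⌈1+r/4⌉-cases 2 = inj₁ refl
⌈1+r/4⌉-cases 3 = inj₁ refl
⌈1+r/4⌉-cases 4 = inj₂ (1 , refl)
⌈1+r/4⌉-cases (suc (suc (suc (suc (suc r))))) with ⌈1+r/4⌉-cases (suc r)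
... | inj₁ eq       = inj₁ (cong suc eq)
... | inj₂ (m , eq) = inj₂ (suc m , trans (cong (4 +_) eq) (sym (*-suc 4 m)))

m∸n≡1+m∸[1+n] : ∀ {m n} → suc n ≤ m → m ∸ n ≡ suc (m ∸ suc n)
m∸n≡1+m∸[1+n] {suc m} (s≤s n≤m) = +-∸-assoc 1 n≤m

residues-differ : ∀ d e f {q q′ r} .{{_ : NonZero d}} {_ : True (e <? d)} {_ : True (f <? d)} →
                  e ≢ f → r ≡ e + d * q → r ≢ f + d * q′
residues-differ d e f {q} {q′} {_} {e<d} {f<d} e≢f r≡e+dq r≡f+dq′ = e≢f (begin
  e                  ≡⟨ m<n⇒m%n≡m (toWitness e<d) ⟨
  e % d              ≡⟨ [m+kn]%n≡m%n e q d ⟨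
  (e + q * d) % d    ≡⟨ cong (λ z → (e + z) % d) (*-comm q d) ⟩
  (e + d * q) % d    ≡⟨ cong (_% d) (trans (sym r≡e+dq) r≡f+dq′) ⟩
  (f + d * q′) % d   ≡⟨ cong (λ z → (f + z) % d) (*-comm d q′) ⟩
  (f + q′ * d) % d   ≡⟨ [m+kn]%n≡m%n f q′ d ⟩
  f % d              ≡⟨ m<n⇒m%n≡m (toWitness f<d) ⟩
  f                  ∎)
  where open ≡-Reasoning

module Circulant (n : ℕ) .{{_ : NonZero n}} where

  [m%n+o]%n≡[m+o]%n : ∀ m o → (m % n + o) % n ≡ (m + o) % n
  [m%n+o]%n≡[m+o]%n m o = begin
    (m % n + o) % n          ≡⟨ %-distribˡ-+ (m % n) o n ⟩
    (m % n % n + o % n) % n  ≡⟨ cong (λ z → (z + o % n) % n) (m%n%n≡m%n m n) ⟩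
    (m % n + o % n) % n      ≡⟨ %-distribˡ-+ m o n ⟨
    (m + o) % n              ∎
    where open ≡-Reasoning

  [m+o%n]%n≡[m+o]%n : ∀ m o → (m + o % n) % n ≡ (m + o) % n
  [m+o%n]%n≡[m+o]%n m o = begin
    (m + o % n) % n  ≡⟨ cong (_% n) (+-comm m (o % n)) ⟩
    (o % n + m) % n  ≡⟨ [m%n+o]%n≡[m+o]%n o m ⟩
    (o + m) % n      ≡⟨ cong (_% n) (+-comm o m) ⟩
    (m + o) % n      ∎
    where open ≡-Reasoning

  %-wrap : ∀ {m} → n ≤ m → m < n + n → m % n + n ≡ m
  %-wrap {m} n≤m m<n+n = begin
    m % n + n          ≡⟨ cong (_+ n) (m≤n⇒[n∸m]%m≡n%m n≤m) ⟨
    (m ∸ n) % n + n    ≡⟨ cong (_+ n) (m<n⇒m%n≡m (m<n+o⇒m∸n<o m n m<n+n)) ⟩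
    m ∸ n + n          ≡⟨ m∸n+n≡m n≤m ⟩
    m                  ∎
    where open ≡-Reasoning

  toℕ-⊕ : ∀ (v : Fin n) m → toℕ (v ⊕ m) ≡ (toℕ v + m) % n
  toℕ-⊕ v m = toℕ-fromℕ< _

  ⊕-assoc : ∀ (v : Fin n) a b → (v ⊕ a) ⊕ b ≡ v ⊕ (a + b)
  ⊕-assoc v a b = toℕ-injective (begin
    toℕ ((v ⊕ a) ⊕ b)          ≡⟨ toℕ-⊕ (v ⊕ a) b ⟩
    (toℕ (v ⊕ a) + b) % n      ≡⟨ cong (λ z → (z + b) % n) (toℕ-⊕ v a) ⟩
    ((toℕ v + a) % n + b) % n  ≡⟨ [m%n+o]%n≡[m+o]%n (toℕ v + a) b ⟩
    (toℕ v + a + b) % n        ≡⟨ cong (_% n) (+-assoc (toℕ v) a b) ⟩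
    (toℕ v + (a + b)) % n      ≡⟨ toℕ-⊕ v (a + b) ⟨
    toℕ (v ⊕ (a + b))          ∎)
    where open ≡-Reasoning

  ⊕-identityʳ : ∀ (v : Fin n) → v ⊕ 0 ≡ v
  ⊕-identityʳ v = toℕ-injective (begin
    toℕ (v ⊕ 0)       ≡⟨ toℕ-⊕ v 0 ⟩
    (toℕ v + 0) % n   ≡⟨ cong (_% n) (+-identityʳ (toℕ v)) ⟩
    toℕ v % n         ≡⟨ m<n⇒m%n≡m (toℕ<n v) ⟩
    toℕ v             ∎)
    where open ≡-Reasoning

  ⊕-n : ∀ (v : Fin n) → v ⊕ n ≡ v
  ⊕-n v = toℕ-injective (begin
    toℕ (v ⊕ n)       ≡⟨ toℕ-⊕ v n ⟩
    (toℕ v + n) % n   ≡⟨ [m+n]%n≡m%n (toℕ v) n ⟩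
    toℕ v % n         ≡⟨ m<n⇒m%n≡m (toℕ<n v) ⟩
    toℕ v             ∎)
    where open ≡-Reasoning

  infixl 6 _⊖_

  _⊖_ : Fin n → Fin n → ℕ
  u ⊖ x = (toℕ u + (n ∸ toℕ x)) % n

  ⊖<n : ∀ (u x : Fin n) → u ⊖ x < n
  ⊖<n u x = m%n<n (toℕ u + (n ∸ toℕ x)) n

  private
    x+[n∸x]≡n : ∀ (x : Fin n) → toℕ x + (n ∸ toℕ x) ≡ n
    x+[n∸x]≡n x = m+[n∸m]≡n (<⇒≤ (toℕ<n x))

  [x⊕r]⊖x≡r%n : ∀ (x : Fin n) r → (x ⊕ r) ⊖ x ≡ r % n
  [x⊕r]⊖x≡r%n x r = begin
    (toℕ (x ⊕ r) + (n ∸ toℕ x)) % n      ≡⟨ cong (λ z → (z + (n ∸ toℕ x)) % n) (toℕ-⊕ x r) ⟩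
    ((toℕ x + r) % n + (n ∸ toℕ x)) % n  ≡⟨ [m%n+o]%n≡[m+o]%n (toℕ x + r) _ ⟩
    (toℕ x + r + (n ∸ toℕ x)) % n        ≡⟨ cong (_% n) (shuffle (toℕ x) r (n ∸ toℕ x)) ⟩
    (r + (toℕ x + (n ∸ toℕ x))) % n      ≡⟨ cong (λ z → (r + z) % n) (x+[n∸x]≡n x) ⟩
    (r + n) % n                          ≡⟨ [m+n]%n≡m%n r n ⟩
    r % n                                ∎
    where
      open ≡-Reasoning
      shuffle : ∀ a b c → a + b + c ≡ b + (a + c)
      shuffle = solve-∀

  x⊕[u⊖x]≡u : ∀ (u x : Fin n) → x ⊕ (u ⊖ x) ≡ u
  x⊕[u⊖x]≡u u x = toℕ-injective (begin
    toℕ (x ⊕ (u ⊖ x))                     ≡⟨ toℕ-⊕ x _ ⟩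
    (toℕ x + (u ⊖ x)) % n                 ≡⟨ [m+o%n]%n≡[m+o]%n (toℕ x) _ ⟩
    (toℕ x + (toℕ u + (n ∸ toℕ x))) % n   ≡⟨ cong (_% n) (shuffle (toℕ x) (toℕ u) (n ∸ toℕ x)) ⟩
    (toℕ u + (toℕ x + (n ∸ toℕ x))) % n   ≡⟨ cong (λ z → (toℕ u + z) % n) (x+[n∸x]≡n x) ⟩
    (toℕ u + n) % n                       ≡⟨ [m+n]%n≡m%n (toℕ u) n ⟩
    toℕ u % n                             ≡⟨ m<n⇒m%n≡m (toℕ<n u) ⟩
    toℕ u                                 ∎)
    where
      open ≡-Reasoning
      shuffle : ∀ a b c → a + (b + c) ≡ b + (a + c)
      shuffle = solve-∀

  [u⊕s]⊖x : ∀ (u x : Fin n) s → (u ⊕ s) ⊖ x ≡ ((u ⊖ x) + s) % n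
  [u⊕s]⊖x u x s = begin
    (u ⊕ s) ⊖ x                ≡⟨ cong (λ z → (z ⊕ s) ⊖ x) (x⊕[u⊖x]≡u u x) ⟨
    ((x ⊕ (u ⊖ x)) ⊕ s) ⊖ x    ≡⟨ cong (_⊖ x) (⊕-assoc x (u ⊖ x) s) ⟩
    (x ⊕ ((u ⊖ x) + s)) ⊖ x    ≡⟨ [x⊕r]⊖x≡r%n x _ ⟩
    ((u ⊖ x) + s) % n            ∎
    where open ≡-Reasoning

  ⊕-injectiveʳ : ∀ (y : Fin n) {a b} → a < n → b < n → y ⊕ a ≡ y ⊕ b → a ≡ b
  ⊕-injectiveʳ y {a} {b} a<n b<n eq = begin
    a             ≡⟨ m<n⇒m%n≡m a<n ⟨
    a % n         ≡⟨ [x⊕r]⊖x≡r%n y a ⟨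
    (y ⊕ a) ⊖ y   ≡⟨ cong (_⊖ y) eq ⟩
    (y ⊕ b) ⊖ y   ≡⟨ [x⊕r]⊖x≡r%n y b ⟩
    b % n         ≡⟨ m<n⇒m%n≡m b<n ⟩
    b             ∎
    where open ≡-Reasoning

  ⊕-suc-distinct : ∀ (y : Fin n) {p} → suc p < n → y ⊕ p ≢ y ⊕ suc p
  ⊕-suc-distinct y {p} 1+p<n eq = <⇒≢ (n<1+n p) (⊕-injectiveʳ y (<-trans (n<1+n p) 1+p<n) 1+p<n eq)

  [[c+p]%n+s]%n≡[c+[p+s]]%n : ∀ c p s → ((c + p) % n + s) % n ≡ (c + (p + s)) % n
  [[c+p]%n+s]%n≡[c+[p+s]]%n c p s = trans ([m%n+o]%n≡[m+o]%n (c + p) s) (cong (_% n) (+-assoc c p s))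

  ‖_‖ : ℕ → ℕ
  ‖ r ‖ = r ⊓ (n ∸ r)

  level : ℕ → ℕ
  level r = ⌈ ‖ r ‖ /4⌉

  private
    ≤-⊓-+ : ∀ {x a b} s → x ≤ a + s → x ≤ b + s → x ≤ a ⊓ b + s
    ≤-⊓-+ {a = a} {b} s x≤a+s x≤b+s =
      ≤-trans (⊓-glb x≤a+s x≤b+s) (≤-reflexive (sym (+-distribʳ-⊓ s a b)))

  ‖‖-shift : ∀ r s → r < n → ‖ r ‖ ≤ ‖ (r + s) % n ‖ + s × ‖ (r + s) % n ‖ ≤ ‖ r ‖ + s
  ‖‖-shift r s r<n with r + s <? n
  ... | yes r+s<n rewrite m<n⇒m%n≡m r+s<n =
      ≤-⊓-+ s (≤-trans (m⊓n≤m r _) (≤-trans (m≤m+n r s) (m≤m+n (r + s) s)))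
              (≤-trans (m⊓n≤n r _) (≤-reflexive n∸r≡n∸[r+s]+s))
    , ≤-⊓-+ s (m⊓n≤m (r + s) _)
              (≤-trans (m⊓n≤n (r + s) _) (≤-trans (∸-monoʳ-≤ n (m≤m+n r s)) (m≤m+n (n ∸ r) s)))
    where
      n∸r≡n∸[r+s]+s : n ∸ r ≡ n ∸ (r + s) + s
      n∸r≡n∸[r+s]+s = begin
        n ∸ r                            ≡⟨ cong (_∸ r) (m+[n∸m]≡n (<⇒≤ r+s<n)) ⟨
        r + s + (n ∸ (r + s)) ∸ r        ≡⟨ cong (_∸ r) (+-assoc r s _) ⟩
        r + (s + (n ∸ (r + s))) ∸ r      ≡⟨ m+n∸m≡n r _ ⟩
        s + (n ∸ (r + s))                ≡⟨ +-comm s _ ⟩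
        n ∸ (r + s) + s                  ∎
        where open ≡-Reasoning
  ... | no r+s≮n =
      ≤-trans (≤-trans (m⊓n≤n r _) n∸r≤s) (m≤n+m s _)
    , ≤-trans (≤-trans (m⊓n≤m t _) t≤s) (m≤n+m s _)
    where
      n≤r+s : n ≤ r + s
      n≤r+s = ≮⇒≥ r+s≮n
      t : ℕ
      t = (r + s) % n
      n∸r≤s : n ∸ r ≤ s
      n∸r≤s = ≤-trans (∸-monoˡ-≤ r n≤r+s) (≤-reflexive (m+n∸m≡n r s))
      t≤s : t ≤ s
      t≤s = begin
        (r + s) % n        ≡⟨ m≤n⇒[n∸m]%m≡n%m n≤r+s ⟨
        (r + s ∸ n) % n    ≤⟨ m%n≤m (r + s ∸ n) n ⟩
        r + s ∸ n          ≤⟨ ∸-monoʳ-≤ (r + s) (<⇒≤ r<n) ⟩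
        r + s ∸ r          ≡⟨ m+n∸m≡n r s ⟩
        s                  ∎
        where open ≤-Reasoning

  ‖r‖≡r : ∀ {r} → r + r ≤ n → ‖ r ‖ ≡ r
  ‖r‖≡r {r} r+r≤n = m≤n⇒m⊓n≡m (m+n≤o⇒m≤o∸n r r+r≤n)

  ‖r‖≡n∸r : ∀ {r} → n ≤ r + r → ‖ r ‖ ≡ n ∸ r
  ‖r‖≡n∸r {r} n≤r+r = m≥n⇒m⊓n≡n (≤-trans (∸-monoˡ-≤ r n≤r+r) (≤-reflexive (m+n∸m≡n r r)))

  gen≤4 : ∀ {s} → Gen s → s ≤ 4
  gen≤4 (inj₁ refl)                = s≤s z≤n
  gen≤4 (inj₂ (inj₁ refl))         = s≤s (s≤s z≤n)
  gen≤4 (inj₂ (inj₂ (inj₁ refl)))  = s≤s (s≤s (s≤s z≤n))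
  gen≤4 (inj₂ (inj₂ (inj₂ refl)))  = ≤-refl

  ‖⊖‖-adjacent : ∀ {u w : Fin n} x → Adj u w → ‖ u ⊖ x ‖ ≤ 4 + ‖ w ⊖ x ‖
  ‖⊖‖-adjacent {u} {w} x (_ , s , gen , inj₁ u⊕s≡w) = begin
    ‖ u ⊖ x ‖                       ≤⟨ proj₁ (‖‖-shift (u ⊖ x) s (⊖<n u x)) ⟩
    ‖ ((u ⊖ x) + s) % n ‖ + s       ≡⟨ cong (λ z → ‖ z ‖ + s) (trans (sym ([u⊕s]⊖x u x s)) (cong (_⊖ x) u⊕s≡w)) ⟩
    ‖ w ⊖ x ‖ + s                   ≤⟨ +-monoʳ-≤ _ (gen≤4 gen) ⟩
    ‖ w ⊖ x ‖ + 4                   ≡⟨ +-comm _ 4 ⟩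
    4 + ‖ w ⊖ x ‖                   ∎
    where open ≤-Reasoning
  ‖⊖‖-adjacent {u} {w} x (_ , s , gen , inj₂ w⊕s≡u) = begin
    ‖ u ⊖ x ‖                       ≡⟨ cong ‖_‖ (trans (cong (_⊖ x) (sym w⊕s≡u)) ([u⊕s]⊖x w x s)) ⟩
    ‖ ((w ⊖ x) + s) % n ‖           ≤⟨ proj₂ (‖‖-shift (w ⊖ x) s (⊖<n w x)) ⟩
    ‖ w ⊖ x ‖ + s                   ≤⟨ +-monoʳ-≤ _ (gen≤4 gen) ⟩
    ‖ w ⊖ x ‖ + 4                   ≡⟨ +-comm _ 4 ⟩
    4 + ‖ w ⊖ x ‖                   ∎
    where open ≤-Reasoning

  x⊖x≡0 : ∀ (x : Fin n) → x ⊖ x ≡ 0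
  x⊖x≡0 x = trans (cong (_% n) (x+[n∸x]≡n x)) (n%n≡0 n)

  level-≤-length : ∀ {u x : Fin n} {m} → Walk u x m → level (u ⊖ x) ≤ m
  level-≤-length {x = x} here = ≤-reflexive (cong level (x⊖x≡0 x))
  level-≤-length {u} {x} (step adj walk) =
    ≤-trans (⌈/4⌉-≤-suc (‖⊖‖-adjacent x adj)) (s≤s (level-≤-length walk))

  Adj-sym : ∀ {u v : Fin n} → Adj u v → Adj v u
  Adj-sym (u≢v , s , gen , inj₁ u⊕s≡v) = ≢-sym u≢v , s , gen , inj₂ u⊕s≡v
  Adj-sym (u≢v , s , gen , inj₂ v⊕s≡u) = ≢-sym u≢v , s , gen , inj₁ v⊕s≡u

  Walk-snoc : ∀ {u v w : Fin n} {m} → Walk u v m → Adj v w → Walk u w (suc m)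
  Walk-snoc here           adj = step adj here
  Walk-snoc (step adj′ walk) adj = step adj′ (Walk-snoc walk adj)

  Walk-reverse : ∀ {u v : Fin n} {m} → Walk u v m → Walk v u m
  Walk-reverse here            = here
  Walk-reverse (step adj walk) = Walk-snoc (Walk-reverse walk) (Adj-sym adj)

  Walk-prepend : ∀ (y : Fin n) {s t m} → Gen (suc s) → suc s + t < n →
                 Walk (y ⊕ t) y m → Walk (y ⊕ (suc s + t)) y (suc m)
  Walk-prepend y {s} {t} gen s+t<n walk = step (distinct , suc s , gen , inj₂ shift) walk
    where
      distinct : y ⊕ (suc s + t) ≢ y ⊕ t
      distinct eq = m≢1+n+m t (sym (⊕-injectiveʳ y s+t<n (≤-<-trans (m≤n+m t (suc s)) s+t<n) eq))
      shift : (y ⊕ t) ⊕ suc s ≡ y ⊕ (suc s + t)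
      shift = trans (⊕-assoc y t (suc s)) (cong (y ⊕_) (+-comm t (suc s)))

  Walk-⌈/4⌉ : ∀ (y : Fin n) r → r < n → Walk (y ⊕ r) y ⌈ r /4⌉
  Walk-⌈/4⌉ y 0 _ = subst (λ v → Walk v y 0) (sym (⊕-identityʳ y)) here
  Walk-⌈/4⌉ y 1 r<n = Walk-prepend y (inj₁ refl) r<n (Walk-⌈/4⌉ y 0 (<-trans z<s r<n))
  Walk-⌈/4⌉ y 2 r<n = Walk-prepend y (inj₂ (inj₁ refl)) r<n (Walk-⌈/4⌉ y 0 (<-trans z<s r<n))
  Walk-⌈/4⌉ y 3 r<n = Walk-prepend y (inj₂ (inj₂ (inj₁ refl))) r<n (Walk-⌈/4⌉ y 0 (<-trans z<s r<n))
  Walk-⌈/4⌉ y 4 r<n = Walk-prepend y (inj₂ (inj₂ (inj₂ refl))) r<n (Walk-⌈/4⌉ y 0 (<-trans z<s r<n))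
  Walk-⌈/4⌉ y (suc (suc (suc (suc (suc t))))) r<n =
    Walk-prepend y (inj₂ (inj₂ (inj₂ refl))) r<n (Walk-⌈/4⌉ y (suc t) (≤-<-trans (m≤n+m (suc t) 4) r<n))

  Walk-level : ∀ (u x : Fin n) → Walk u x (level (u ⊖ x))
  Walk-level u x with u ⊖ x ≤? n ∸ (u ⊖ x)
  ... | yes r≤n∸r = subst₂ (λ v m → Walk v x m) (x⊕[u⊖x]≡u u x) (cong ⌈_/4⌉ (sym (m≤n⇒m⊓n≡m r≤n∸r)))
                      (Walk-⌈/4⌉ x r (⊖<n u x))
    where r = u ⊖ x
  ... | no  r≰n∸r = subst (Walk u x) (cong ⌈_/4⌉ (sym (m≥n⇒m⊓n≡n (<⇒≤ (≰⇒> r≰n∸r)))))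
                      (Walk-reverse (subst (λ v → Walk v u ⌈ n ∸ r /4⌉) u⊕[n∸r]≡x
                        (Walk-⌈/4⌉ u (n ∸ r) n∸r<n)))
    where
      r = u ⊖ x
      n∸r<n : n ∸ r < n
      n∸r<n = ∸-monoʳ-< (≤-<-trans z≤n (≰⇒> r≰n∸r)) (<⇒≤ (⊖<n u x))
      u⊕[n∸r]≡x : u ⊕ (n ∸ r) ≡ x
      u⊕[n∸r]≡x = begin
        u ⊕ (n ∸ r)               ≡⟨ cong (_⊕ (n ∸ r)) (x⊕[u⊖x]≡u u x) ⟨
        (x ⊕ r) ⊕ (n ∸ r)         ≡⟨ ⊕-assoc x r (n ∸ r) ⟩
        x ⊕ (r + (n ∸ r))         ≡⟨ cong (x ⊕_) (m+[n∸m]≡n (<⇒≤ (⊖<n u x))) ⟩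
        x ⊕ n                     ≡⟨ ⊕-n x ⟩
        x                         ∎
        where open ≡-Reasoning

  IsDist⇒≡level : ∀ {u x : Fin n} {m} → IsDist u x m → m ≡ level (u ⊖ x)
  IsDist⇒≡level {u} {x} (walk , shortest) = ≤-antisym (shortest _ (Walk-level u x)) (level-≤-length walk)

  SameRep-⊕ : ∀ (X : Subset n) (a : Fin n) p q →
              (∀ x → x ∈ X → level (((a ⊖ x) + p) % n) ≡ level (((a ⊖ x) + q) % n)) →
              SameRep X (a ⊕ p) (a ⊕ q)
  SameRep-⊕ X a p q same x x∈X m₁ m₂ d₁ d₂ = begin
    m₁                              ≡⟨ IsDist⇒≡level d₁ ⟩
    level ((a ⊕ p) ⊖ x)             ≡⟨ cong level ([u⊕s]⊖x a x p) ⟩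
    level (((a ⊖ x) + p) % n)       ≡⟨ same x x∈X ⟩
    level (((a ⊖ x) + q) % n)       ≡⟨ cong level ([u⊕s]⊖x a x q) ⟨
    level ((a ⊕ q) ⊖ x)             ≡⟨ IsDist⇒≡level d₂ ⟨
    m₂                              ∎
    where open ≡-Reasoning

Resolves-∈ : ∀ {n} .{{_ : NonZero n}} {X : Subset n} {As : List (Block n)} {B : Block n} {a b} →
             Resolves X As → B ∈ₗ As → B a → B b → a ≢ b → ¬ SameRep X a b
Resolves-∈ res B∈As Ba Bb =
  res (Any.index B∈As) _ _ (subst (λ C → C _) (lookup-index B∈As) Ba)
                           (subst (λ C → C _) (lookup-index B∈As) Bb)

covering-Vec : ∀ {n} m → Fin n → (X : Subset n) → ∣ X ∣ ≤ m →
               Σ[ xs ∈ Vec (Fin n) m ] (∀ {x} → x ∈ X → x ∈ᵥ xs)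
covering-Vec zero _ X ∣X∣≤0 = [] , λ x∈X → contradiction (≤-trans (x∈p⇒∣p-x∣<∣p∣ x∈X) ∣X∣≤0) n≮0
covering-Vec (suc m) d X ∣X∣≤1+m with nonempty? X
... | no  empty = replicate (suc m) d , λ x∈X → contradiction (_ , x∈X) empty
... | yes (y , y∈X) with covering-Vec m d (X - y) (s≤s⁻¹ (≤-trans (x∈p⇒∣p-x∣<∣p∣ y∈X) ∣X∣≤1+m))
...   | ys , X-y⊆ys = y ∷ ys , cover
  where
    cover : ∀ {x} → x ∈ X → x ∈ᵥ y ∷ ys
    cover {x} x∈X with x ≟ᶠ y
    ... | yes x≡y = here x≡y
    ... | no  x≢y = there (X-y⊆ys (x∈p∧x≢y⇒x∈p-y x∈X x≢y))

Independent : ℕ → (ℕ → Set) → Set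
Independent l P = (∀ j → P j → ¬ P (suc j)) × (P 0 → ¬ P l)

Covers : ℕ → (ℕ → Set) → (ℕ → Set) → Set
Covers m P Q = (∀ i → i ≤ m → P (2 * i) ⊎ Q (2 * i))
             × (∀ i → i < m → P (suc (2 * i)) ⊎ Q (suc (2 * i)))

Covers-swap : ∀ {m P Q} → Covers m P Q → Covers m Q P
Covers-swap (evens , odds) = (λ i i≤m → Sum.swap (evens i i≤m)) , (λ i i<m → Sum.swap (odds i i<m))

alternation : ∀ {m P Q} → Independent (2 * m) P → Independent (2 * m) Q → Covers m P Q →
              P 0 → ∀ i → i ≤ m → P (2 * i)
alternation _ _ _ P0 zero _ = P0
alternation {Q = Q} P-indep Q-indep (evens , odds) P0 (suc i) 1+i≤m
  with odds i 1+i≤m | evens (suc i) 1+i≤m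
... | inj₁ P[1+2i] | _            = contradiction P[1+2i] (proj₁ P-indep _ P[2i])
  where P[2i] = alternation P-indep Q-indep (evens , odds) P0 i (<⇒≤ 1+i≤m)
... | inj₂ _       | inj₁ P[2+2i] = P[2+2i]
... | inj₂ Q[1+2i] | inj₂ Q[2+2i] = contradiction (subst Q (*-suc 2 i) Q[2+2i]) (proj₁ Q-indep _ Q[1+2i])

odd-cycle-not-covered : ∀ {P Q} m → Independent (2 * m) P → Independent (2 * m) Q → ¬ Covers m P Q
odd-cycle-not-covered {P} {Q} m P-indep Q-indep covers with proj₁ covers 0 z≤n
... | inj₁ P0 = proj₂ P-indep P0 (alternation P-indep Q-indep covers P0 m ≤-refl)
... | inj₂ Q0 = proj₂ Q-indep Q0 (alternation Q-indep P-indep (Covers-swap {m} {P} {Q} covers) Q0 m ≤-refl)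

module _ (k : ℕ) where
  open Circulant (N k)

  -- level changes between r and r + 1 (r < n) only at a boundary: on the way up at r = 0, 4, …, 4k,
  -- on the way down at the mirror images n − 1 − 4q = 2 + 4(2k + 1 − q).
  data Boundary (r : ℕ) : Set where
    rising  : ∀ {q} → q ≤ k → r ≡ 4 * q → Boundary r
    falling : ∀ {q} → k < q → r ≡ 2 + 4 * q → Boundary r

  Boundary⇒even : ∀ {r} → Boundary r → ∃[ h ] r ≡ 2 * h
  Boundary⇒even (rising  {q} _ r≡4q)   = 2 * q , trans r≡4q (*-assoc 2 2 q)
  Boundary⇒even (falling {q} _ r≡2+4q) = 1 + 2 * q , trans r≡2+4q (2+4q≡2*[1+2q] q)
    where
      2+4q≡2*[1+2q] : ∀ q → 2 + 4 * q ≡ 2 * (1 + 2 * q)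
      2+4q≡2*[1+2q] = solve-∀

  Boundary⇒odd-absurd : ∀ {r h} → Boundary r → r ≢ 1 + 2 * h
  Boundary⇒odd-absurd {h = h} br with Boundary⇒even br
  ... | h′ , r≡2h′ = residues-differ 2 0 1 {h′} {h} (λ ()) r≡2h′

  Boundary-mirror : ∀ {r q} → q ≤ k → r + 4 * q ≡ 6 + 8 * k → Boundary r
  Boundary-mirror {r} {q} q≤k r+4q≡6+8k = falling (s≤s (m≤m+n k e)) (+-cancelʳ-≡ (4 * q) r _ (begin
    r + 4 * q                        ≡⟨ r+4q≡6+8k ⟩
    6 + 8 * k                        ≡⟨ cong (λ z → 6 + 8 * z) q+e≡k ⟨
    6 + 8 * (q + e)                  ≡⟨ expand q e ⟩
    2 + 4 * suc (q + e + e) + 4 * q  ≡⟨ cong (λ z → 2 + 4 * suc (z + e) + 4 * q) q+e≡k ⟩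
    2 + 4 * suc (k + e) + 4 * q      ∎))
    where
      open ≡-Reasoning
      e = k ∸ q
      q+e≡k : q + e ≡ k
      q+e≡k = m+[n∸m]≡n q≤k
      expand : ∀ q e → 6 + 8 * (q + e) ≡ 2 + 4 * suc (q + e + e) + 4 * q
      expand = solve-∀

  8q≤n⇒q≤k : ∀ {q} → 4 * q + 4 * q ≤ N k → q ≤ k
  8q≤n⇒q≤k {q} 8q≤n with q ≤? k
  ... | yes q≤k = q≤k
  ... | no  q≰k = contradiction (≤-trans (+-mono-≤ 4[1+k]≤4q 4[1+k]≤4q) 8q≤n) (<⇒≱ n<8[1+k])
    where
      4[1+k]≤4q : 4 * suc k ≤ 4 * q
      4[1+k]≤4q = *-monoʳ-≤ 4 (≰⇒> q≰k)
      n<8[1+k] : N k < 4 * suc k + 4 * suc k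
      n<8[1+k] = ≤-reflexive (identity k)
        where
          identity : ∀ k → suc (7 + 8 * k) ≡ 4 * suc k + 4 * suc k
          identity = solve-∀

  level-step-up : ∀ {r} → suc r + suc r ≤ N k → level (suc r) ≡ level r ⊎ Boundary r
  level-step-up {r} 2[1+r]≤n = Sum.map same-level rising-at (⌈1+r/4⌉-cases r)
    where
      2r≤n : r + r ≤ N k
      2r≤n = ≤-trans (+-mono-≤ (n≤1+n r) (n≤1+n r)) 2[1+r]≤n
      same-level : ⌈ suc r /4⌉ ≡ ⌈ r /4⌉ → level (suc r) ≡ level r
      same-level eq = begin
        ⌈ ‖ suc r ‖ /4⌉  ≡⟨ cong ⌈_/4⌉ (‖r‖≡r 2[1+r]≤n) ⟩
        ⌈ suc r /4⌉      ≡⟨ eq ⟩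
        ⌈ r /4⌉          ≡⟨ cong ⌈_/4⌉ (‖r‖≡r 2r≤n) ⟨
        ⌈ ‖ r ‖ /4⌉      ∎
        where open ≡-Reasoning
      rising-at : ∃[ q ] r ≡ 4 * q → Boundary r
      rising-at (q , r≡4q) = rising (8q≤n⇒q≤k {q} (subst (λ z → z + z ≤ N k) r≡4q 2r≤n)) r≡4q

  level-step-middle : ∀ {r} → r + r < N k → N k < suc r + suc r → level (suc r) ≡ level r
  level-step-middle {r} 2r<n n<2[1+r] = begin
    ⌈ ‖ suc r ‖ /4⌉   ≡⟨ cong ⌈_/4⌉ (‖r‖≡n∸r (<⇒≤ n<2[1+r])) ⟩
    ⌈ N k ∸ suc r /4⌉ ≡⟨ cong (λ m → ⌈ m ∸ suc r /4⌉) n≡1+2r ⟩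
    ⌈ r + r ∸ r /4⌉   ≡⟨ cong ⌈_/4⌉ (m+n∸m≡n r r) ⟩
    ⌈ r /4⌉           ≡⟨ cong ⌈_/4⌉ (‖r‖≡r (<⇒≤ 2r<n)) ⟨
    ⌈ ‖ r ‖ /4⌉       ∎
    where
      open ≡-Reasoning
      n≡1+2r : N k ≡ suc (r + r)
      n≡1+2r = ≤-antisym (≤-trans (s≤s⁻¹ n<2[1+r]) (≤-reflexive (+-suc r r))) 2r<n

  level-step-down : ∀ {r} → N k ≤ r + r → suc r < N k → level (suc r) ≡ level r ⊎ Boundary r
  level-step-down {r} n≤2r 1+r<n = Sum.map same-level falling-at (⌈1+r/4⌉-cases s)
    where
      s = N k ∸ suc r
      ‖1+r‖≡s : ‖ suc r ‖ ≡ s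
      ‖1+r‖≡s = ‖r‖≡n∸r (≤-trans n≤2r (+-mono-≤ (n≤1+n r) (n≤1+n r)))
      ‖r‖≡1+s : ‖ r ‖ ≡ suc s
      ‖r‖≡1+s = trans (‖r‖≡n∸r n≤2r) (m∸n≡1+m∸[1+n] (<⇒≤ 1+r<n))
      same-level : ⌈ suc s /4⌉ ≡ ⌈ s /4⌉ → level (suc r) ≡ level r
      same-level eq = begin
        ⌈ ‖ suc r ‖ /4⌉  ≡⟨ cong ⌈_/4⌉ ‖1+r‖≡s ⟩
        ⌈ s /4⌉          ≡⟨ eq ⟨
        ⌈ suc s /4⌉      ≡⟨ cong ⌈_/4⌉ ‖r‖≡1+s ⟨
        ⌈ ‖ r ‖ /4⌉      ∎
        where open ≡-Reasoning
      1+r+s≡n : suc r + s ≡ N k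
      1+r+s≡n = m+[n∸m]≡n (<⇒≤ 1+r<n)
      s≤r : s ≤ r
      s≤r = begin
        N k ∸ suc r     ≤⟨ ∸-monoˡ-≤ (suc r) n≤2r ⟩
        r + r ∸ suc r   ≤⟨ ∸-monoʳ-≤ (r + r) (n≤1+n r) ⟩
        r + r ∸ r       ≡⟨ m+n∸m≡n r r ⟩
        r               ∎
        where open ≤-Reasoning
      falling-at : ∃[ q ] s ≡ 4 * q → Boundary r
      falling-at (q , s≡4q) = Boundary-mirror (8q≤n⇒q≤k {q} 8q≤n) (suc-injective 1+r+4q≡n)
        where
          1+r+4q≡n : suc (r + 4 * q) ≡ N k
          1+r+4q≡n = trans (cong (suc r +_) (sym s≡4q)) 1+r+s≡n
          8q≤n : 4 * q + 4 * q ≤ N k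
          8q≤n = begin
            4 * q + 4 * q  ≡⟨ cong₂ _+_ s≡4q s≡4q ⟨
            s + s          ≤⟨ +-monoˡ-≤ s (≤-trans s≤r (n≤1+n r)) ⟩
            suc r + s      ≡⟨ 1+r+s≡n ⟩
            N k            ∎
            where open ≤-Reasoning

  level-step : ∀ r → r < N k → level ((r + 1) % N k) ≡ level r ⊎ Boundary r
  level-step r r<n with suc r <? N k
  ... | no  1+r≮n = inj₂ (Boundary-mirror z≤n (trans (+-identityʳ r) (suc-injective 1+r≡n)))
    where 1+r≡n = ≤-antisym r<n (≮⇒≥ 1+r≮n)
  ... | yes 1+r<n rewrite +-comm r 1 | m<n⇒m%n≡m 1+r<n with suc r + suc r ≤? N k | r + r <? N k
  ...   | yes 2[1+r]≤n | _       = level-step-up 2[1+r]≤n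
  ...   | no  2[1+r]≰n | yes 2r<n = inj₁ (level-step-middle 2r<n (≰⇒> 2[1+r]≰n))
  ...   | no  _        | no 2r≮n  = level-step-down (≮⇒≥ 2r≮n) 1+r<n

  Boundary-gap-2 : ∀ {r} → Boundary r → ¬ Boundary (r + 2)
  Boundary-gap-2 {r} (rising {q} _ r≡4q) (rising {q′} _ r+2≡4q′) =
    residues-differ 4 2 0 {q} {q′} (λ ()) (trans (cong (_+ 2) r≡4q) (+-comm (4 * q) 2)) r+2≡4q′
  Boundary-gap-2 {r} (rising {q} q≤k r≡4q) (falling {q′} k<q′ r+2≡2+4q′) =
    <⇒≱ (subst (k <_) (sym q≡q′) k<q′) q≤k
    where
      q≡q′ : q ≡ q′
      q≡q′ = *-cancelˡ-≡ q q′ 4 (+-cancelˡ-≡ 2 _ _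
               (trans (trans (+-comm 2 (4 * q)) (cong (_+ 2) (sym r≡4q))) r+2≡2+4q′))
  Boundary-gap-2 {r} (falling {q} k<q r≡2+4q) (rising {q′} q′≤k r+2≡4q′) =
    <⇒≱ (subst (k <_) 1+q≡q′ (m<n⇒m<1+n k<q)) q′≤k
    where
      1+q≡q′ : suc q ≡ q′
      1+q≡q′ = *-cancelˡ-≡ (suc q) q′ 4 (trans (shift q) (trans (cong (_+ 2) (sym r≡2+4q)) r+2≡4q′))
        where
          shift : ∀ q → 4 * suc q ≡ 2 + 4 * q + 2
          shift = solve-∀
  Boundary-gap-2 {r} (falling {q} _ r≡2+4q) (falling {q′} _ r+2≡2+4q′) =
    residues-differ 4 0 2 {suc q} {q′} (λ ()) (trans (cong (_+ 2) r≡2+4q) (shift q)) r+2≡2+4q′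
    where
      shift : ∀ q → 2 + 4 * q + 2 ≡ 4 * suc q
      shift = solve-∀

  Boundary-gap-2-mod : ∀ {r} → r < N k → Boundary r → ¬ Boundary ((r + 2) % N k)
  Boundary-gap-2-mod {r} r<n br with r + 2 <? N k
  ... | yes r+2<n = Boundary-gap-2 br ∘ subst Boundary (m<n⇒m%n≡m r+2<n)
  ... | no  r+2≮n = wrapped _ (%-wrap (≮⇒≥ r+2≮n) (+-mono-<-≤ r<n (s≤s (s≤s z≤n))))
    where
      wrapped : ∀ t → t + N k ≡ r + 2 → ¬ Boundary t
      wrapped 0 n≡r+2 _ =
        Boundary⇒odd-absurd {h = 2 + 4 * k} br (+-cancelʳ-≡ 2 r _ (trans (sym n≡r+2) (n≡1+2[2+4k]+2 k)))
        where
          n≡1+2[2+4k]+2 : ∀ k → 7 + 8 * k ≡ 1 + 2 * (2 + 4 * k) + 2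
          n≡1+2[2+4k]+2 = solve-∀
      wrapped 1 _ b1 = Boundary⇒odd-absurd {h = 0} b1 refl
      wrapped (suc (suc t)) 2+t+n≡r+2 _ =
        <⇒≱ r<n (≤-trans (m≤n+m (N k) t) (≤-reflexive t+n≡r))
        where t+n≡r = suc-injective (suc-injective (trans 2+t+n≡r+2 (+-comm r 2)))

  Boundary-gap-far : ∀ {r} → r + (4 + 4 * k) < N k → Boundary r → ¬ Boundary (r + (4 + 4 * k))
  Boundary-gap-far {r} _ (rising {q} _ r≡4q) (rising {q′} q′≤k r+h≡4q′) =
    <⇒≱ (subst (k <_) q+1+k≡q′ (m≤n+m (suc k) q)) q′≤k
    where
      q+1+k≡q′ : q + suc k ≡ q′
      q+1+k≡q′ = *-cancelˡ-≡ _ q′ 4 (trans (shift q k) (trans (cong (_+ (4 + 4 * k)) (sym r≡4q)) r+h≡4q′))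
        where
          shift : ∀ q k → 4 * (q + suc k) ≡ 4 * q + (4 + 4 * k)
          shift = solve-∀
  Boundary-gap-far {r} _ (rising {q} _ r≡4q) (falling {q′} _ r+h≡2+4q′) =
    residues-differ 4 0 2 {q + suc k} {q′} (λ ()) (trans (cong (_+ (4 + 4 * k)) r≡4q) (shift q k)) r+h≡2+4q′
    where
      shift : ∀ q k → 4 * q + (4 + 4 * k) ≡ 4 * (q + suc k)
      shift = solve-∀
  Boundary-gap-far {r} r+h<n (falling {q} k<q r≡2+4q) _ = <⇒≱ r+h<n (begin
    7 + 8 * k                      ≤⟨ m≤n+m (7 + 8 * k) 3 ⟩
    3 + (7 + 8 * k)                ≡⟨ shift k ⟩
    2 + 4 * suc k + (4 + 4 * k)    ≤⟨ +-monoˡ-≤ (4 + 4 * k) (+-monoʳ-≤ 2 (*-monoʳ-≤ 4 k<q)) ⟩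
    2 + 4 * q + (4 + 4 * k)        ≡⟨ cong (_+ (4 + 4 * k)) r≡2+4q ⟨
    r + (4 + 4 * k)                ∎)
    where
      open ≤-Reasoning
      shift : ∀ k → 3 + (7 + 8 * k) ≡ 2 + 4 * suc k + (4 + 4 * k)
      shift = solve-∀

  Boundary-gap-far-wrapped : ∀ {t r} → t + N k ≡ r + (4 + 4 * k) → Boundary t → ¬ Boundary r
  Boundary-gap-far-wrapped {t} {r} t+n≡r+h bt with Boundary⇒even bt
  ... | h , t≡2h = λ br → Boundary⇒odd-absurd {h = h + suc (2 * k)} br (+-cancelʳ-≡ (4 + 4 * k) r _ (begin
    r + (4 + 4 * k)                          ≡⟨ t+n≡r+h ⟨
    t + N k                                  ≡⟨ cong (_+ N k) t≡2h ⟩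
    2 * h + (7 + 8 * k)                      ≡⟨ shift h k ⟩
    1 + 2 * (h + suc (2 * k)) + (4 + 4 * k)  ∎))
    where
      open ≡-Reasoning
      shift : ∀ h k → 2 * h + (7 + 8 * k) ≡ 1 + 2 * (h + suc (2 * k)) + (4 + 4 * k)
      shift = solve-∀

  Boundary-gap-far-mod : ∀ {r} → r < N k → Boundary r → ¬ Boundary ((r + (4 + 4 * k)) % N k)
  Boundary-gap-far-mod {r} r<n br with r + (4 + 4 * k) <? N k
  ... | yes r+h<n = Boundary-gap-far r+h<n br ∘ subst Boundary (m<n⇒m%n≡m r+h<n)
  ... | no  r+h≮n = λ bt → Boundary-gap-far-wrapped (%-wrap (≮⇒≥ r+h≮n) (+-mono-<-≤ r<n h≤n)) bt br
    where
      h≤n : 4 + 4 * k ≤ N k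
      h≤n = ≤-trans (m≤m+n (4 + 4 * k) (3 + 4 * k)) (≤-reflexive (split k))
        where
          split : ∀ k → 4 + 4 * k + (3 + 4 * k) ≡ 7 + 8 * k
          split = solve-∀

  Boundary-positions-independent : ∀ c → Independent (2 * suc k) (λ j → Boundary ((c + 2 * j) % N k))
  Boundary-positions-independent c = gap-2 , gap-far
    where
      gap-2 : ∀ j → Boundary ((c + 2 * j) % N k) → ¬ Boundary ((c + 2 * suc j) % N k)
      gap-2 j b = Boundary-gap-2-mod (m%n<n (c + 2 * j) (N k)) b ∘ subst Boundary (sym (begin
        ((c + 2 * j) % N k + 2) % N k  ≡⟨ [[c+p]%n+s]%n≡[c+[p+s]]%n c (2 * j) 2 ⟩
        (c + (2 * j + 2)) % N k        ≡⟨ cong (λ p → (c + p) % N k) (+-comm (2 * j) 2) ⟩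
        (c + (2 + 2 * j)) % N k        ≡⟨ cong (λ p → (c + p) % N k) (*-suc 2 j) ⟨
        (c + 2 * suc j) % N k          ∎))
        where open ≡-Reasoning
      gap-far : Boundary ((c + 0) % N k) → ¬ Boundary ((c + 2 * (2 * suc k)) % N k)
      gap-far b = Boundary-gap-far-mod (m%n<n (c + 0) (N k)) b ∘ subst Boundary (sym (begin
        ((c + 0) % N k + (4 + 4 * k)) % N k  ≡⟨ [[c+p]%n+s]%n≡[c+[p+s]]%n c 0 (4 + 4 * k) ⟩
        (c + (4 + 4 * k)) % N k              ≡⟨ cong (λ p → (c + p) % N k) (4+4k≡2[2[1+k]] k) ⟩
        (c + 2 * (2 * suc k)) % N k          ∎))
        where
          open ≡-Reasoning
          4+4k≡2[2[1+k]] : ∀ k → 4 + 4 * k ≡ 2 * (2 * suc k)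
          4+4k≡2[2[1+k]] = solve-∀

  level-step-at : ∀ c p → level ((c + p) % N k) ≡ level ((c + suc p) % N k) ⊎ Boundary ((c + p) % N k)
  level-step-at c p =
    Sum.map₁ (λ eq → sym (trans (cong level shift) eq)) (level-step ((c + p) % N k) (m%n<n (c + p) (N k)))
    where
      shift : (c + suc p) % N k ≡ ((c + p) % N k + 1) % N k
      shift = sym (trans ([[c+p]%n+s]%n≡[c+[p+s]]%n c p 1) (cong (λ q → (c + q) % N k) (+-comm p 1)))

  unresolved⇒Boundary : ∀ (X : Subset (N k)) a x₁ x₂ → (∀ {x} → x ∈ X → x ∈ᵥ x₁ ∷ x₂ ∷ []) →
                        ∀ p → ¬ SameRep X (a ⊕ p) (a ⊕ suc p) →
                        Boundary (((a ⊖ x₁) + p) % N k) ⊎ Boundary (((a ⊖ x₂) + p) % N k)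
  unresolved⇒Boundary X a x₁ x₂ X⊆x₁x₂ p unresolved
    with level-step-at (a ⊖ x₁) p | level-step-at (a ⊖ x₂) p
  ... | inj₂ b₁ | _       = inj₁ b₁
  ... | inj₁ _  | inj₂ b₂ = inj₂ b₂
  ... | inj₁ e₁ | inj₁ e₂ = contradiction (SameRep-⊕ X a p (suc p) same) unresolved
    where
      same : ∀ x → x ∈ X → level (((a ⊖ x) + p) % N k) ≡ level (((a ⊖ x) + suc p) % N k)
      same x x∈X with X⊆x₁x₂ x∈X
      ... | here refl         = e₁
      ... | there (here refl) = e₂

  blocks : Fin (N k) → ℕ → List (Block (N k))
  blocks a i = Ablk k a i ∷ₗ Bblk k a i ∷ₗ []ₗ

  Ablk∈clusterA : ∀ a i → i ≤ suc k → Ablk k a i ∈ₗ clusterA k a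
  Ablk∈clusterA a i i≤1+k with m≤n⇒m<n∨m≡n i≤1+k
  ... | inj₁ i<1+k = ∈-++⁺ˡ (∈-concatMap⁺ (blocks a) (Any.map (λ { refl → Any.here refl }) (∈-upTo⁺ i<1+k)))
  ... | inj₂ refl  = ∈-++⁺ʳ (concatMap (blocks a) (upTo (suc k))) (Any.here refl)

  Bblk∈clusterA : ∀ a i → i < suc k → Bblk k a i ∈ₗ clusterA k a
  Bblk∈clusterA a i i<1+k =
    ∈-++⁺ˡ (∈-concatMap⁺ (blocks a) (Any.map (λ { refl → Any.there (Any.here refl) }) (∈-upTo⁺ i<1+k)))

  1+2j<n : ∀ {j} → j ≤ 2 * suc k → suc (2 * j) < N k
  1+2j<n {j} j≤2[1+k] = begin
    suc (suc (2 * j))          ≤⟨ s≤s (s≤s (*-monoʳ-≤ 2 j≤2[1+k])) ⟩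
    2 + 2 * (2 * suc k)        ≡⟨ expand k ⟩
    6 + 4 * k                  ≤⟨ m≤m+n (6 + 4 * k) (1 + 4 * k) ⟩
    6 + 4 * k + (1 + 4 * k)    ≡⟨ collect k ⟩
    N k                        ∎
    where
      open ≤-Reasoning
      expand : ∀ k → 2 + 2 * (2 * suc k) ≡ 6 + 4 * k
      expand = solve-∀
      collect : ∀ k → 6 + 4 * k + (1 + 4 * k) ≡ 7 + 8 * k
      collect = solve-∀

  clusterA-Covers : ∀ a (X : Subset (N k)) x₁ x₂ → (∀ {x} → x ∈ X → x ∈ᵥ x₁ ∷ x₂ ∷ []) →
                    Resolves X (clusterA k a) →
                    Covers (suc k) (λ j → Boundary (((a ⊖ x₁) + 2 * j) % N k))
                                   (λ j → Boundary (((a ⊖ x₂) + 2 * j) % N k))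
  clusterA-Covers a X x₁ x₂ X⊆x₁x₂ res = evens , odds
    where
      Separated : ℕ → Set
      Separated j = Boundary (((a ⊖ x₁) + 2 * j) % N k) ⊎ Boundary (((a ⊖ x₂) + 2 * j) % N k)
      resolved-pair : ∀ {B} j → j ≤ 2 * suc k → B ∈ₗ clusterA k a → B (a ⊕ (2 * j)) → B (a ⊕ suc (2 * j)) →
                      Separated j
      resolved-pair j j≤2[1+k] B∈ first second = unresolved⇒Boundary X a x₁ x₂ X⊆x₁x₂ (2 * j)
        (Resolves-∈ res B∈ first second (⊕-suc-distinct a (1+2j<n j≤2[1+k])))
      evens : ∀ i → i ≤ suc k → Separated (2 * i)
      evens i i≤1+k = resolved-pair (2 * i) (*-monoʳ-≤ 2 i≤1+k) (Ablk∈clusterA a i i≤1+k)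
        (inj₁ (cong (a ⊕_) 2[2i]≡4i)) (inj₂ (cong (a ⊕_) (trans (cong suc 2[2i]≡4i) (+-comm 1 (4 * i)))))
        where
          2[2i]≡4i : 2 * (2 * i) ≡ 4 * i
          2[2i]≡4i = sym (*-assoc 2 2 i)
      odds : ∀ i → i < suc k → Separated (suc (2 * i))
      odds i i<1+k = resolved-pair (suc (2 * i)) 1+2i≤2[1+k] (Bblk∈clusterA a i i<1+k)
        (inj₁ (cong (a ⊕_) (2[1+2i]≡2+4i i))) (inj₂ (cong (a ⊕_) (cong suc (2[1+2i]≡2+4i i))))
        where
          2[1+2i]≡2+4i : ∀ i → 2 * suc (2 * i) ≡ 2 + 4 * i
          2[1+2i]≡2+4i = solve-∀
          1+2i≤2[1+k] : suc (2 * i) ≤ 2 * suc k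
          1+2i≤2[1+k] = ≤-trans (n≤1+n _) (≤-trans (≤-reflexive (sym (*-suc 2 i))) (*-monoʳ-≤ 2 i<1+k))

  two-landmarks-do-not-resolve : ∀ a (X : Subset (N k)) x₁ x₂ → (∀ {x} → x ∈ X → x ∈ᵥ x₁ ∷ x₂ ∷ []) →
                                 ¬ Resolves X (clusterA k a)
  two-landmarks-do-not-resolve a X x₁ x₂ X⊆x₁x₂ res =
    odd-cycle-not-covered (suc k)
      (Boundary-positions-independent (a ⊖ x₁)) (Boundary-positions-independent (a ⊖ x₂))
      (clusterA-Covers a X x₁ x₂ X⊆x₁x₂ res)

lemma3p10 : (k : ℕ) → 1 ≤ k → (a : Fin (N k)) →
    (S : Subset (N k)) → IsSCluster S (clusterA k a) →
    (X : Subset (N k)) → Resolves X (clusterA k a) → 3 ≤ ∣ X ∣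
lemma3p10 k _ a _ _ X res with 3 ≤? ∣ X ∣
... | yes 3≤∣X∣ = 3≤∣X∣
... | no  3≰∣X∣ with covering-Vec 2 a X (s≤s⁻¹ (≰⇒> 3≰∣X∣))
...   | x₁ ∷ x₂ ∷ [] , X⊆x₁x₂ =
  contradiction res (two-landmarks-do-not-resolve k a X x₁ x₂ X⊆x₁x₂)
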